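{- Let $b$ and $b'$ be observationally equivalent legal queue behaviors. Then for every position $i$, the $i$-th element of $b$ is a dequeue event returning $\mathtt{NULL}$ if and only if the $i$-th element of $b'$ is a dequeue event returning $\mathtt{NULL}$.
   Context: A queue event is a tuple $(u,m,d_{in},d_{out})$ with a globally unique identifier $u$ and method $m\in\{\mathtt{enq},\mathtt{deq}\}$; an enqueue event of value $x\in\mathbb{N}$ is written $\mathtt{enq}(x)$ and a dequeue event returning $x\in\mathbb{N}\cup\{\mathtt{NULL}\}$ is written $\mathtt{deq}(x)$. A queue behavior is a finite duplicate-free sequence of queue events. $\mathsf{LTS}_Q$ has states finite sequences over $\mathbb{N}$, initial state $\varepsilon$, and transitions $q\xrightarrow{\mathtt{enq}(x)}q\cdot x$, $x\cdot q'\xrightarrow{\mathtt{deq}(x)}q'$ ($x\in\mathbb{N}$), $\varepsilon\xrightarrow{\mathtt{deq}(\mathtt{NULL})}\varepsilon$. A behavior is legal if it is the label sequence of a run of $\mathsf{LTS}_Q$ from $\varepsilon$. Two behaviors are observationally equivalent if their subsequences of enqueue events coincide and their subsequences of dequeue events coincide. -}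

module Defs where

open import Data.Nat using (ℕ)
open import Data.Maybe using (Maybe; just; nothing)
open import Data.List using (List; []; _∷_; _++_; [_]; map; filterᵇ)
open import Data.List.Relation.Unary.Unique.Propositional using (Unique)
open import Data.Product using (Σ; ∃; _×_; _,_)
open import Data.Bool using (Bool; true; false)
open import Relation.Binary.PropositionalEquality using (_≡_)

data Method : Set where
  enq deq : Method

-- A queue event (u , m , d_in , d_out).  Data values are Maybe ℕ;
-- `nothing` is the special value NULL / no-argument.
record Event : Set where
  constructor event
  field
    uid  : ℕ
    meth : Method
    din  : Maybe ℕ
    dout : Maybe ℕ
open Event public

data IsEnq : Event → ℕ → Set where
  isEnq : ∀ {u x dout} → IsEnq (event u enq (just x) dout) x

data IsDeq : Event → Maybe ℕ → Set where
  isDeq : ∀ {u din r} → IsDeq (event u deq din r) r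

-- enq(x) : method enq with argument x.  deq(r) : method deq returning r.
-- (The remaining component is unconstrained, it is not observed by LTS_Q.)

-- A queue behavior: finite duplicate-free sequence of events
-- (unique identifiers are globally unique, so duplicate-freeness of events).
Behavior : Set
Behavior = List Event

IsBehavior : Behavior → Set
IsBehavior b = Unique b

data Step : List ℕ → Event → List ℕ → Set where
  stepEnq  : ∀ {q e x} → IsEnq e x → Step q e (q ++ [ x ])
  stepDeq  : ∀ {q e x} → IsDeq e (just x) → Step (x ∷ q) e q
  stepNull : ∀ {e} → IsDeq e nothing → Step [] e []

data Run : List ℕ → List Event → Set where
  done : ∀ {q} → Run q []
  step : ∀ {q q' e es} → Step q e q' → Run q' es → Run q (e ∷ es)

Legal : Behavior → Set
Legal b = Run [] b

isEnqᵇ : Event → Bool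
isEnqᵇ e with meth e
... | enq = true
... | deq = false

isDeqᵇ : Event → Bool
isDeqᵇ e with meth e
... | enq = false
... | deq = true

enqs : Behavior → List Event
enqs = filterᵇ isEnqᵇ

deqs : Behavior → List Event
deqs = filterᵇ isDeqᵇ

ObsEquiv : Behavior → Behavior → Set
ObsEquiv b b' = (enqs b ≡ enqs b') × (deqs b ≡ deqs b')

-- i-th element (0-based) of a list, if it exists.
_!_ : {A : Set} → List A → ℕ → Maybe A
[] ! _ = nothing
(x ∷ xs) ! ℕ.zero = just x
(x ∷ xs) ! ℕ.suc i = xs ! i

DeqNullAt : Behavior → ℕ → Set
DeqNullAt b i = ∃ λ e → (b ! i ≡ just e) × IsDeq e nothing

-- When a dequeue returns NULL the queue is empty, so every value enqueued before it has
-- already been returned by an earlier dequeue.  Hence the position of a NULL-dequeue in a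
-- legal behavior is determined by the dequeues preceding it: it is their number plus the
-- number of them that returned a value.  Observationally equivalent behaviors have the same
-- dequeue subsequence, so the same NULL-dequeue is preceded by the same dequeues in both and
-- therefore sits at the same position.
module Submission where

open import Defs
open import Data.Nat using (ℕ; zero; suc; pred; _+_)
open import Data.Nat.Properties using (+-suc; +-comm)
open import Data.Product using (_×_; _,_; ∃; ∃₂)
open import Data.List using (List; []; _∷_; _++_; [_]; length)
open import Data.List.Properties using (length-++; filter-++; ∷-injectiveˡ; ∷-injectiveʳ)
open import Data.Maybe using (just; nothing)
open import Data.Bool.Properties using (T?)
open import Function using (_∘_)
open import Relation.Binary.PropositionalEquality
  using (_≡_; refl; sym; trans; cong; cong₂; subst; module ≡-Reasoning)

private
  variable
    A : Set
    x : A
    q : List ℕ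
    e : Event
    p r : Behavior

!-length : (ys zs : List A) → (ys ++ x ∷ zs) ! length ys ≡ just x
!-length []       zs = refl
!-length (y ∷ ys) zs = !-length ys zs

!-split : (xs : List A) (i : ℕ) → xs ! i ≡ just x →
          ∃₂ λ ys zs → xs ≡ ys ++ x ∷ zs × length ys ≡ i
!-split (y ∷ xs) zero    refl = [] , xs , refl , refl
!-split (y ∷ xs) (suc i) xs!i with !-split xs i xs!i
... | ys , zs , refl , refl = y ∷ ys , zs , refl , refl

++-injectiveˡ-≡length : (xs ys : List A) {zs ws : List A} → length xs ≡ length ys →
                        xs ++ zs ≡ ys ++ ws → xs ≡ ys
++-injectiveˡ-≡length []       []       _   _  = refl
++-injectiveˡ-≡length (x ∷ xs) (y ∷ ys) len eq =
  cong₂ _∷_ (∷-injectiveˡ eq) (++-injectiveˡ-≡length xs ys (cong pred len) (∷-injectiveʳ eq))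

deqs-++ : (xs ys : Behavior) → deqs (xs ++ ys) ≡ deqs xs ++ deqs ys
deqs-++ = filter-++ (T? ∘ isDeqᵇ)

length≡enqs+deqs : (b : Behavior) → length b ≡ length (enqs b) + length (deqs b)
length≡enqs+deqs []                    = refl
length≡enqs+deqs (event _ enq _ _ ∷ b) = cong suc (length≡enqs+deqs b)
length≡enqs+deqs (event _ deq _ _ ∷ b) =
  trans (cong suc (length≡enqs+deqs b)) (sym (+-suc _ _))

deqs-split : (b : Behavior) (j : ℕ) → deqs b ! j ≡ just e →
             ∃₂ λ p r → b ≡ p ++ e ∷ r × length (deqs p) ≡ j
deqs-split (event u enq din dout ∷ b) j deqs!j with deqs-split b j deqs!j
... | p , r , refl , refl = event u enq din dout ∷ p , r , refl , refl
deqs-split (event u deq din dout ∷ b) zero refl = [] , b , refl , refl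
deqs-split (event u deq din dout ∷ b) (suc j) deqs!j with deqs-split b j deqs!j
... | p , r , refl , refl = event u deq din dout ∷ p , r , refl , refl

#returned : List Event → ℕ
#returned []                           = 0
#returned (event _ _ _ (just _) ∷ es) = suc (#returned es)
#returned (event _ _ _ nothing ∷ es)  = #returned es

-- Conservation of values: those present or enqueued are either returned or still queued.
run-++ : (p : Behavior) → Run q (p ++ r) →
         ∃ λ q' → Run q' r × length q + length (enqs p) ≡ length q' + #returned (deqs p)
run-++ []      run = _ , run , refl
run-++ {q} (_ ∷ p) (step (stepEnq {x = x} isEnq) run) with run-++ p run
... | q' , run' , balance = q' , run' , (begin
  length q + suc (length (enqs p))      ≡⟨ +-suc (length q) _ ⟩
  suc (length q) + length (enqs p)      ≡⟨ cong (_+ length (enqs p)) (+-comm 1 (length q)) ⟩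
  length q + 1 + length (enqs p)        ≡˘⟨ cong (_+ length (enqs p)) (length-++ q {[ x ]}) ⟩
  length (q ++ [ x ]) + length (enqs p) ≡⟨ balance ⟩
  length q' + #returned (deqs p)        ∎)
  where open ≡-Reasoning
run-++ (_ ∷ p) (step (stepDeq isDeq) run) with run-++ p run
... | q' , run' , balance = q' , run' , trans (cong suc balance) (sym (+-suc _ _))
run-++ (_ ∷ p) (step (stepNull isDeq) run) = run-++ p run

nullDeq⇒empty : Run q (e ∷ r) → IsDeq e nothing → q ≡ []
nullDeq⇒empty (step (stepNull _) _)    _     = refl
nullDeq⇒empty (step (stepDeq ()) _)    isDeq
nullDeq⇒empty (step (stepEnq isEnq) _) ()

nullDeq-position : (p : Behavior) → Legal (p ++ e ∷ r) → IsDeq e nothing →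
                   length p ≡ #returned (deqs p) + length (deqs p)
nullDeq-position p legal null with run-++ p legal
... | q' , run , balance with refl ← nullDeq⇒empty run null =
  trans (length≡enqs+deqs p) (cong (_+ length (deqs p)) balance)

deqNullAt-transfer : (b b' : Behavior) → Legal b → Legal b' → deqs b ≡ deqs b' →
                     (i : ℕ) → DeqNullAt b i → DeqNullAt b' i
deqNullAt-transfer b b' legal legal' deqs≡ i (e , b!i , null@isDeq)
  with !-split b i b!i
... | p , r , refl , refl
  with deqs-split b' (length (deqs p)) (subst (λ ds → ds ! length (deqs p) ≡ just e)
                                              (trans (sym (deqs-++ p (e ∷ r))) deqs≡)
                                              (!-length (deqs p) (deqs r)))
... | p' , r' , refl , |deqs-p'| = e , subst (λ k → b' ! k ≡ just e) p'≡p (!-length p' r') , null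
  where
  same-deqs : deqs p' ≡ deqs p
  same-deqs = ++-injectiveˡ-≡length (deqs p') (deqs p) |deqs-p'|
    (trans (sym (deqs-++ p' (e ∷ r'))) (trans (sym deqs≡) (deqs-++ p (e ∷ r))))

  p'≡p : length p' ≡ length p
  p'≡p = trans (nullDeq-position p' legal' null)
        (trans (cong (λ ds → #returned ds + length ds) same-deqs)
               (sym (nullDeq-position p legal null)))

lemma3p5 : (b b' : Behavior) → IsBehavior b → IsBehavior b' →
           Legal b → Legal b' → ObsEquiv b b' →
           (i : ℕ) → (DeqNullAt b i → DeqNullAt b' i) × (DeqNullAt b' i → DeqNullAt b i)
lemma3p5 b b' _ _ legal legal' (_ , deqs≡) i =
  deqNullAt-transfer b b' legal legal' deqs≡ i ,
  deqNullAt-transfer b' b legal' legal (sym deqs≡) i
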